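{- Let $x=\mathrm{Av}(213)\,x^-$ be a nonempty reduced word over $\mathcal A$ (first letter $\mathrm{Av}(213)$, remainder $x^-$), let $\mathcal X$ be the class represented by $x$ and $\mathcal X^-$ the class represented by $x^-$. A permutation $\pi$ belongs to $\mathcal X^-$ if and only if $\pi$ is contained in a sum-indecomposable permutation $\sigma$ such that $\sigma\oplus1\in\mathcal X$.
   Context: $\mathcal C[\mathcal E]$ is the set of inflations $\sigma[\tau_1,\dots,\tau_k]$ with $\sigma\in\mathcal C$, $\tau_i\in\mathcal E$. The alphabet is $\mathcal A=\{\mathsf I,\mathsf D,\mathrm{Av}(213),\mathrm{Av}(312),\mathrm{Av}(132),\mathrm{Av}(231)\}$ ($\mathsf I,\mathsf D$ increasing and decreasing permutations). A word $w_1\cdots w_n$ represents $w_1[w_2[\cdots[w_n]\cdots]]$; the empty word represents $\{\emptyset,1\}$. A word is reduced if it has no two consecutive letters among $\mathsf I\mathsf I$, $\mathsf D\mathsf D$, $\mathsf I\,\mathrm{Av}(312)$, $\mathsf I\,\mathrm{Av}(231)$, $\mathsf D\,\mathrm{Av}(132)$, $\mathsf D\,\mathrm{Av}(213)$, $\mathrm{Av}(312)\,\mathsf D$, $\mathrm{Av}(231)\,\mathsf D$, $\mathrm{Av}(132)\,\mathsf I$, $\mathrm{Av}(213)\,\mathsf I$. -}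

module Defs where

open import Data.Nat as ℕ using (ℕ; zero; suc)
open import Data.Fin as Fin using (Fin; toℕ; opposite; join; splitAt)
open import Data.Fin.Properties using (splitAt-join; join-splitAt)
open import Data.Sum as Sum using (_⊎_; inj₁; inj₂)
open import Data.Product using (Σ; _×_; _,_; ∃; ∃-syntax)
open import Data.List using (List; []; _∷_)
open import Data.Unit using (⊤; tt)
open import Data.Empty using (⊥)
open import Function using (_∘_; _⇔_)
open import Relation.Nullary using (¬_)
open import Relation.Binary.PropositionalEquality using (_≡_; refl; cong; sym; trans)

record Perm : Set where
  constructor perm
  field
    size : ℕ
    fun  : Fin size → Fin size
    inj  : ∀ {i j} → fun i ≡ fun j → i ≡ j
open Perm public

Class : Set₁
Class = Perm → Set

_≼_ : Perm → Perm → Set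
π ≼ σ = Σ (Fin (size π) → Fin (size σ)) λ e →
          (∀ i j → i Fin.< j → e i Fin.< e j) ×
          (∀ i j → (fun π i Fin.< fun π j) ⇔ (fun σ (e i) Fin.< fun σ (e j)))

private
  t213 t312 t132 t231 : Fin 3 → Fin 3
  t213 Fin.zero = Fin.suc Fin.zero
  t213 (Fin.suc Fin.zero) = Fin.zero
  t213 (Fin.suc (Fin.suc Fin.zero)) = Fin.suc (Fin.suc Fin.zero)
  t312 Fin.zero = Fin.suc (Fin.suc Fin.zero)
  t312 (Fin.suc Fin.zero) = Fin.zero
  t312 (Fin.suc (Fin.suc Fin.zero)) = Fin.suc Fin.zero
  t132 Fin.zero = Fin.zero
  t132 (Fin.suc Fin.zero) = Fin.suc (Fin.suc Fin.zero)
  t132 (Fin.suc (Fin.suc Fin.zero)) = Fin.suc Fin.zero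
  t231 Fin.zero = Fin.suc Fin.zero
  t231 (Fin.suc Fin.zero) = Fin.suc (Fin.suc Fin.zero)
  t231 (Fin.suc (Fin.suc Fin.zero)) = Fin.zero

  inj3 : (f g : Fin 3 → Fin 3) → (∀ i → g (f i) ≡ i) → ∀ {i j} → f i ≡ f j → i ≡ j
  inj3 f g gf {i} {j} eq = trans (sym (gf i)) (trans (cong g eq) (gf j))

  inv213 : ∀ i → t213 (t213 i) ≡ i
  inv213 Fin.zero = refl
  inv213 (Fin.suc Fin.zero) = refl
  inv213 (Fin.suc (Fin.suc Fin.zero)) = refl
  inv132 : ∀ i → t132 (t132 i) ≡ i
  inv132 Fin.zero = refl
  inv132 (Fin.suc Fin.zero) = refl
  inv132 (Fin.suc (Fin.suc Fin.zero)) = refl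
  inv312 : ∀ i → t231 (t312 i) ≡ i
  inv312 Fin.zero = refl
  inv312 (Fin.suc Fin.zero) = refl
  inv312 (Fin.suc (Fin.suc Fin.zero)) = refl
  inv231 : ∀ i → t312 (t231 i) ≡ i
  inv231 Fin.zero = refl
  inv231 (Fin.suc Fin.zero) = refl
  inv231 (Fin.suc (Fin.suc Fin.zero)) = refl

p213 p312 p132 p231 : Perm
p213 = perm 3 t213 (inj3 t213 t213 inv213)
p312 = perm 3 t312 (inj3 t312 t231 inv312)
p132 = perm 3 t132 (inj3 t132 t132 inv132)
p231 = perm 3 t231 (inj3 t231 t312 inv231)

Av : Perm → Class
Av β π = ¬ (β ≼ π)

Incr : Class
Incr π = ∀ i → fun π i ≡ i

Decr : Class
Decr π = ∀ i → fun π i ≡ opposite i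

-- Inflation  C[E] = { σ[τ₁,…,τ_k] : σ ∈ C, τ_c ∈ E }.
-- π = σ[τ₁,…,τ_k] is expressed by a monotone surjective block map
-- b : positions of π → positions of σ (each block nonempty and consisting of
-- consecutive positions); entries in different blocks c ≠ d compare as
-- σ(c), σ(d) do (so each block is an interval of values); and the entries of
-- block c, read left to right, form the pattern τ_c.
record Inflation (C E : Class) (π : Perm) : Set where
  field
    σ     : Perm
    σ∈C   : C σ
    block : Fin (size π) → Fin (size σ)
    mono  : ∀ i j → i Fin.≤ j → block i Fin.≤ block j
    surj  : ∀ c → ∃[ i ] block i ≡ c
    cross : ∀ i j → ¬ (block i ≡ block j) →
              (fun π i Fin.< fun π j) ⇔ (fun σ (block i) Fin.< fun σ (block j))
    τ     : Fin (size σ) → Perm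
    τ∈E   : ∀ c → E (τ c)
    emb   : ∀ c → Fin (size (τ c)) → Fin (size π)
    emb-incr : ∀ c t u → t Fin.< u → emb c t Fin.< emb c u
    emb-in   : ∀ c t → block (emb c t) ≡ c
    emb-onto : ∀ c i → block i ≡ c → ∃[ t ] emb c t ≡ i
    emb-iso  : ∀ c t u → (fun (τ c) t Fin.< fun (τ c) u) ⇔ (fun π (emb c t) Fin.< fun π (emb c u))

_[_] : Class → Class → Class
C [ E ] = Inflation C E

data Letter : Set where
  I D A213 A312 A132 A231 : Letter

letterClass : Letter → Class
letterClass I    = Incr
letterClass D    = Decr
letterClass A213 = Av p213
letterClass A312 = Av p312
letterClass A132 = Av p132
letterClass A231 = Av p231

⟦_⟧ : List Letter → Class
⟦ [] ⟧ π = size π ℕ.≤ 1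
⟦ a ∷ w ⟧ = letterClass a [ ⟦ w ⟧ ]

Forbidden : Letter → Letter → Set
Forbidden I I = ⊤
Forbidden D D = ⊤
Forbidden I A312 = ⊤
Forbidden I A231 = ⊤
Forbidden D A132 = ⊤
Forbidden D A213 = ⊤
Forbidden A312 D = ⊤
Forbidden A231 D = ⊤
Forbidden A132 I = ⊤
Forbidden A213 I = ⊤
Forbidden _ _ = ⊥

Reduced : List Letter → Set
Reduced [] = ⊤
Reduced (a ∷ []) = ⊤
Reduced (a ∷ b ∷ w) = ¬ Forbidden a b × Reduced (b ∷ w)

private
  ⊕1fun : ∀ {n} → (Fin n → Fin n) → Fin (n ℕ.+ 1) → Fin (n ℕ.+ 1)
  ⊕1fun {n} f = join n 1 ∘ Sum.map₁ f ∘ splitAt n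

  map₁-inj : ∀ {n} (f : Fin n → Fin n) → (∀ {i j} → f i ≡ f j → i ≡ j) →
             ∀ {x y : Fin n ⊎ Fin 1} → Sum.map₁ f x ≡ Sum.map₁ f y → x ≡ y
  map₁-inj f fi {inj₁ x} {inj₁ y} eq = cong inj₁ (fi (inj₁-inj eq))
    where
      inj₁-inj : ∀ {a b : Fin _} → inj₁ {B = Fin 1} a ≡ inj₁ b → a ≡ b
      inj₁-inj refl = refl
  map₁-inj f fi {inj₂ x} {inj₂ .x} refl = refl

  ⊕1inj : ∀ {n} (f : Fin n → Fin n) → (∀ {i j} → f i ≡ f j → i ≡ j) →
          ∀ {i j} → ⊕1fun f i ≡ ⊕1fun f j → i ≡ j
  ⊕1inj {n} f fi {i} {j} eq =
    trans (sym (join-splitAt n 1 i))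
      (trans (cong (join n 1)
               (map₁-inj f fi {splitAt n i} {splitAt n j}
                 (trans (sym (splitAt-join n 1 (Sum.map₁ f (splitAt n i))))
                   (trans (cong (splitAt n) eq) (splitAt-join n 1 (Sum.map₁ f (splitAt n j)))))))
             (join-splitAt n 1 j))

_⊕1 : Perm → Perm
σ ⊕1 = perm (size σ ℕ.+ 1) (⊕1fun (fun σ)) (⊕1inj (fun σ) (inj σ))

SumDecomposable : Perm → Set
SumDecomposable σ = ∃[ m ] (0 ℕ.< m × m ℕ.< size σ ×
   (∀ i j → toℕ i ℕ.< m → m ℕ.≤ toℕ j → fun σ i Fin.< fun σ j))

SumIndecomposable : Perm → Set
SumIndecomposable σ = 0 ℕ.< size σ × ¬ SumDecomposable σ

-- Both directions rest on the fact that every class here is closed under containment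
-- (deleting one point from an inflation deletes it from its block, or deletes a singleton
-- block from the skeleton).
--
-- (⇒) Appending a new minimum to π ∈ X⁻ as a singleton block keeps the skeleton in the class
-- of the first letter of x⁻, unless that letter is I (excluded by reducedness) or Av(231), in
-- which case prepending a new maximum works instead; either way π lies in a sum-indecomposable
-- σ ∈ X⁻, and σ ⊕ 1 = 12[σ, 1] ∈ Av(213)[X⁻].
--
-- (⇐) If σ ⊕ 1 = α[τ₁, …] with α ∈ Av(213) and σ sum-indecomposable, all of σ lies in a single
-- block τ_b: an entry of σ in an earlier block would either split σ as a sum or produce a
-- 213 in α together with the block of the final maximum.  Hence σ ≼ τ_b ∈ X⁻.

module Submission where

open import Defs
open import Data.Empty using (⊥-elim)
open import Data.Fin as Fin using (Fin; zero; suc; toℕ; fromℕ; punchIn; punchOut; opposite; inject₁; _↑ˡ_; _↑ʳ_)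
import Data.Fin.Properties as FP
open import Data.List using (List; []; _∷_)
open import Data.Nat as ℕ using (ℕ; zero; suc; z≤n; s≤s)
import Data.Nat.Properties as ℕP
open import Data.Product using (_×_; ∃-syntax; Σ; _,_; proj₁; proj₂)
import Data.Sum as Sum
open import Data.Unit using (tt)
open import Function using (_⇔_; _∘_; _∋_; Equivalence; mk⇔)
open import Function.Construct.Composition using () renaming (equivalence to infixr 5 _⟨⇔⟩_)
open import Function.Construct.Identity using (⇔-id)
open import Function.Construct.Symmetry using (⇔-sym)
open import Relation.Binary.Definitions using (tri<; tri≈; tri>)
open import Relation.Binary.PropositionalEquality hiding ([_])
open import Relation.Nullary using (¬_; yes; no)
open import Relation.Nullary.Decidable using (¬?; decidable-stable)

open Equivalence using (to; from)

≢∧≮⇒> : ∀ {n} {i j : Fin n} → i ≢ j → ¬ (i Fin.< j) → j Fin.< i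
≢∧≮⇒> i≢j i≮j = FP.≤∧≢⇒< (ℕP.≮⇒≥ i≮j) (i≢j ∘ sym)

<-resp-≡-⇔ : ∀ {n} {x x′ y y′ : Fin n} → x ≡ x′ → y ≡ y′ → (x Fin.< y) ⇔ (x′ Fin.< y′)
<-resp-≡-⇔ refl refl = ⇔-id _

<-resp-toℕ-⇔ : ∀ {m n} {x y : Fin m} {x′ y′ : Fin n} →
               toℕ x ≡ toℕ x′ → toℕ y ≡ toℕ y′ → (x Fin.< y) ⇔ (x′ Fin.< y′)
<-resp-toℕ-⇔ x≡x′ y≡y′ = subst₂ (λ u v → _ ⇔ (u ℕ.< v)) x≡x′ y≡y′ (⇔-id _)

opposite-anti-< : ∀ {n} {i j : Fin n} → i Fin.< j → opposite j Fin.< opposite i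
opposite-anti-< {n} {i} {j} i<j rewrite FP.opposite-prop i | FP.opposite-prop j =
  ℕP.∸-monoʳ-< {m = n} (s≤s i<j) (FP.toℕ<n j)

StrictlyIncreasing : ∀ {a b} → (Fin a → Fin b) → Set
StrictlyIncreasing e = ∀ i j → i Fin.< j → e i Fin.< e j

module StrictlyIncreasing {a b} {e : Fin a → Fin b} (e-inc : StrictlyIncreasing e) where

  cancel-< : ∀ {i j} → e i Fin.< e j → i Fin.< j
  cancel-< {i} {j} lt with FP.<-cmp i j
  ... | tri< i<j _ _ = i<j
  ... | tri≈ _ refl _ = ⊥-elim (FP.<-irrefl refl lt)
  ... | tri> _ _ j<i = ⊥-elim (FP.<-asym lt (e-inc j i j<i))

  injective : ∀ {i j} → e i ≡ e j → i ≡ j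
  injective {i} {j} eq with FP.<-cmp i j
  ... | tri< i<j _ _ = ⊥-elim (FP.<-irrefl eq (e-inc i j i<j))
  ... | tri≈ _ i≡j _ = i≡j
  ... | tri> _ _ j<i = ⊥-elim (FP.<-irrefl (sym eq) (e-inc j i j<i))

  <-⇔ : ∀ i j → i Fin.< j ⇔ e i Fin.< e j
  <-⇔ i j = mk⇔ (e-inc i j) cancel-<

  mono-≤ : ∀ {i j} → i Fin.≤ j → e i Fin.≤ e j
  mono-≤ {i} {j} i≤j with i FP.≟ j
  ... | yes refl = ℕP.≤-refl
  ... | no i≢j = ℕP.<⇒≤ (e-inc i j (FP.≤∧≢⇒< i≤j i≢j))

  cancel-≤ : ∀ {i j} → e i Fin.≤ e j → i Fin.≤ j
  cancel-≤ ei≤ej = ℕP.≮⇒≥ (λ j<i → ℕP.<⇒≱ (e-inc _ _ j<i) ei≤ej)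

strictlyIncreasing-inflationary : ∀ {a b} {e : Fin a → Fin b} → StrictlyIncreasing e →
                                  ∀ i → toℕ i ℕ.≤ toℕ (e i)
strictlyIncreasing-inflationary e-inc zero = z≤n
strictlyIncreasing-inflationary {e = e} e-inc (suc i) =
  ℕP.≤-<-trans (strictlyIncreasing-inflationary (λ j k j<k → e-inc _ _ (inject₁-mono j<k)) i)
               (e-inc _ _ (FP.≤̄⇒inject₁< ℕP.≤-refl))
  where
    inject₁-mono : ∀ {j k} → j Fin.< k → inject₁ j Fin.< inject₁ k
    inject₁-mono {j} {k} = to (<-resp-toℕ-⇔ (sym (FP.toℕ-inject₁ j)) (sym (FP.toℕ-inject₁ k)))

-- Conjugating by opposite turns the lower bound toℕ i ≤ toℕ (e i) into an upper bound.
strictlyIncreasing⇒≗id : ∀ {a} {e : Fin a → Fin a} → StrictlyIncreasing e → ∀ i → e i ≡ i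
strictlyIncreasing⇒≗id {a} {e} e-inc i =
  FP.toℕ-injective (ℕP.≤-antisym ei≤i (strictlyIncreasing-inflationary e-inc i))
  where
    conj-inc : StrictlyIncreasing (opposite ∘ e ∘ opposite)
    conj-inc j k j<k = opposite-anti-< (e-inc _ _ (opposite-anti-< j<k))
    lower : toℕ (opposite i) ℕ.≤ toℕ (opposite (e i))
    lower = subst (λ z → toℕ (opposite i) ℕ.≤ toℕ (opposite (e z))) (FP.opposite-involutive i)
              (strictlyIncreasing-inflationary conj-inc (opposite i))
    ei≤i : toℕ (e i) ℕ.≤ toℕ i
    ei≤i = ℕP.≮⇒≥ (λ i<ei → ℕP.<⇒≱ (opposite-anti-< i<ei) lower)

punchIn-mono-< : ∀ {n} (p : Fin (suc n)) → StrictlyIncreasing (punchIn p)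
punchIn-mono-< p i j i<j =
  FP.≤∧≢⇒< (FP.punchIn-mono-≤ p i j (ℕP.<⇒≤ i<j)) (FP.<⇒≢ i<j ∘ FP.punchIn-injective p i j)

module PunchIn {n} (p : Fin (suc n)) = StrictlyIncreasing (punchIn-mono-< p)

punchOut-<-⇔ : ∀ {n} {p j k : Fin (suc n)} (p≢j : p ≢ j) (p≢k : p ≢ k) →
               j Fin.< k ⇔ punchOut p≢j Fin.< punchOut p≢k
punchOut-<-⇔ {p = p} p≢j p≢k =
  <-resp-≡-⇔ (sym (FP.punchIn-punchOut p≢j)) (sym (FP.punchIn-punchOut p≢k)) ⟨⇔⟩
  ⇔-sym (PunchIn.<-⇔ p _ _)

≼-trans : ∀ {ρ σ π} → ρ ≼ σ → σ ≼ π → ρ ≼ π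
≼-trans (e , e-inc , e-iso) (f , f-inc , f-iso) =
  f ∘ e , (λ i j i<j → f-inc _ _ (e-inc i j i<j)) , λ i j → e-iso i j ⟨⇔⟩ f-iso (e i) (e j)

≼⇒size≤ : ∀ {ρ π} → ρ ≼ π → size ρ ℕ.≤ size π
≼⇒size≤ (e , e-inc , _) = FP.injective⇒≤ (StrictlyIncreasing.injective e-inc)

-- Deleting and inserting a point

module _ {m} (f : Fin (suc m) → Fin (suc m)) (f-inj : ∀ {i j} → f i ≡ f j → i ≡ j) (p : Fin (suc m)) where

  private
    f-punchIn≢ : ∀ i → f p ≢ f (punchIn p i)
    f-punchIn≢ i eq = FP.punchInᵢ≢i p i (sym (f-inj eq))

  deleteFun : Fin m → Fin m
  deleteFun i = punchOut (f-punchIn≢ i)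

  deleteFun-injective : ∀ {i j} → deleteFun i ≡ deleteFun j → i ≡ j
  deleteFun-injective {i} {j} eq =
    FP.punchIn-injective p i j (f-inj (FP.punchOut-injective (f-punchIn≢ i) (f-punchIn≢ j) eq))

  deleteFun-<-⇔ : ∀ i j → deleteFun i Fin.< deleteFun j ⇔ f (punchIn p i) Fin.< f (punchIn p j)
  deleteFun-<-⇔ i j = ⇔-sym (punchOut-<-⇔ (f-punchIn≢ i) (f-punchIn≢ j))

delete : (ρ : Perm) → Fin (size ρ) → Perm
delete (perm (suc m) f f-inj) p = perm m (deleteFun f f-inj p) (deleteFun-injective f f-inj p)

kept : (ρ : Perm) (p : Fin (size ρ)) → Fin (size (delete ρ p)) → Fin (size ρ)
kept (perm (suc m) _ _) p = punchIn p

kept-inc : ∀ ρ p → StrictlyIncreasing (kept ρ p)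
kept-inc (perm (suc m) _ _) p = punchIn-mono-< p

kept-≢ : ∀ ρ p i → kept ρ p i ≢ p
kept-≢ (perm (suc m) _ _) p i = FP.punchInᵢ≢i p i

keptIndex : ∀ ρ p u → u ≢ p → Fin (size (delete ρ p))
keptIndex (perm (suc m) _ _) p u u≢p = punchOut (u≢p ∘ sym)

kept-keptIndex : ∀ ρ p u u≢p → kept ρ p (keptIndex ρ p u u≢p) ≡ u
kept-keptIndex (perm (suc m) _ _) p u u≢p = FP.punchIn-punchOut _

delete-<-⇔ : ∀ ρ p i j →
             fun (delete ρ p) i Fin.< fun (delete ρ p) j ⇔ fun ρ (kept ρ p i) Fin.< fun ρ (kept ρ p j)
delete-<-⇔ (perm (suc m) f f-inj) p = deleteFun-<-⇔ f f-inj p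

suc-size-delete : ∀ ρ p → suc (size (delete ρ p)) ≡ size ρ
suc-size-delete (perm (suc m) _ _) p = refl

delete-≼ : ∀ ρ p → delete ρ p ≼ ρ
delete-≼ ρ p = kept ρ p , kept-inc ρ p , delete-<-⇔ ρ p

module Delete (ρ : Perm) (p : Fin (size ρ)) where

  open StrictlyIncreasing (kept-inc ρ p) public

  keptIndex-cong : ∀ u v u≢p v≢p → u ≡ v → keptIndex ρ p u u≢p ≡ keptIndex ρ p v v≢p
  keptIndex-cong u v u≢p v≢p u≡v =
    injective (trans (kept-keptIndex ρ p u u≢p) (trans u≡v (sym (kept-keptIndex ρ p v v≢p))))

  keptIndex-mono-< : ∀ u v u≢p v≢p → u Fin.< v → keptIndex ρ p u u≢p Fin.< keptIndex ρ p v v≢p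
  keptIndex-mono-< u v u≢p v≢p =
    cancel-< ∘ to (<-resp-≡-⇔ (sym (kept-keptIndex ρ p u u≢p)) (sym (kept-keptIndex ρ p v v≢p)))

  kept-surjective : ∀ u → u ≢ p → ∃[ i ] kept ρ p i ≡ u
  kept-surjective u u≢p = keptIndex ρ p u u≢p , kept-keptIndex ρ p u u≢p

  keptIndex-<-⇔ : ∀ u v u≢p v≢p →
    fun ρ u Fin.< fun ρ v ⇔ fun (delete ρ p) (keptIndex ρ p u u≢p) Fin.< fun (delete ρ p) (keptIndex ρ p v v≢p)
  keptIndex-<-⇔ u v u≢p v≢p =
    <-resp-≡-⇔ (cong (fun ρ) (sym (kept-keptIndex ρ p u u≢p))) (cong (fun ρ) (sym (kept-keptIndex ρ p v v≢p)))
    ⟨⇔⟩ ⇔-sym (delete-<-⇔ ρ p _ _)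

data InsertView {n} (p : Fin (suc n)) : Fin (suc n) → Set where
  at      : InsertView p p
  punched : (i : Fin n) → InsertView p (punchIn p i)

insertView : ∀ {n} (p j : Fin (suc n)) → InsertView p j
insertView zero zero = at
insertView zero (suc j) = punched j
insertView {suc n} (suc p) zero = punched zero
insertView {suc n} (suc p) (suc j) with insertView p j
... | at = at
... | punched i = punched (suc i)

insertView-at : ∀ {n} (p : Fin (suc n)) → insertView p p ≡ at
insertView-at zero = refl
insertView-at {suc n} (suc p) rewrite insertView-at p = refl

insertView-punched : ∀ {n} (p : Fin (suc n)) i → insertView p (punchIn p i) ≡ punched i
insertView-punched zero i = refl
insertView-punched {suc n} (suc p) zero = refl
insertView-punched {suc n} (suc p) (suc i) rewrite insertView-punched p i = refl

module _ {n} (f : Fin n → Fin n) (p v : Fin (suc n)) where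

  insertFun : Fin (suc n) → Fin (suc n)
  insertFun j with insertView p j
  ... | at = v
  ... | punched i = punchIn v (f i)

  insertFun-at : insertFun p ≡ v
  insertFun-at rewrite insertView-at p = refl

  insertFun-punchIn : ∀ i → insertFun (punchIn p i) ≡ punchIn v (f i)
  insertFun-punchIn i rewrite insertView-punched p i = refl

  insertFun-injective : (∀ {i j} → f i ≡ f j → i ≡ j) → ∀ {j k} → insertFun j ≡ insertFun k → j ≡ k
  insertFun-injective f-inj {j} {k} eq with insertView p j | insertView p k
  ... | at        | at         = refl
  ... | at        | punched i  = ⊥-elim (FP.punchInᵢ≢i v (f i) (sym eq))
  ... | punched i | at         = ⊥-elim (FP.punchInᵢ≢i v (f i) eq)
  ... | punched i | punched i′ = cong (punchIn p) (f-inj (FP.punchIn-injective v _ _ eq))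

insert : (ρ : Perm) (p v : Fin (suc (size ρ))) → Perm
insert ρ p v = perm (suc (size ρ)) (insertFun (fun ρ) p v) (insertFun-injective (fun ρ) p v (inj ρ))

insert-<-⇔ : ∀ ρ p v i j →
  fun ρ i Fin.< fun ρ j ⇔ fun (insert ρ p v) (punchIn p i) Fin.< fun (insert ρ p v) (punchIn p j)
insert-<-⇔ ρ p v i j =
  PunchIn.<-⇔ v _ _ ⟨⇔⟩
  <-resp-≡-⇔ (sym (insertFun-punchIn (fun ρ) p v i)) (sym (insertFun-punchIn (fun ρ) p v j))

≼-insert : ∀ ρ p v → ρ ≼ insert ρ p v
≼-insert ρ p v = punchIn p , punchIn-mono-< p , insert-<-⇔ ρ p v

≼-insert⁻ : ∀ {β α p v} ((e , _) : β ≼ insert α p v) → (∀ t → e t ≢ p) → β ≼ α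
≼-insert⁻ {β} {α} {p} {v} (e , e-inc , e-iso) e≢p =
  e′ , (λ t u t<u → to (punchOut-<-⇔ (p≢e t) (p≢e u)) (e-inc t u t<u)) ,
  λ t u → e-iso t u ⟨⇔⟩
          <-resp-≡-⇔ (cong (fun (insert α p v)) (sym (FP.punchIn-punchOut (p≢e t))))
                     (cong (fun (insert α p v)) (sym (FP.punchIn-punchOut (p≢e u)))) ⟨⇔⟩
          ⇔-sym (insert-<-⇔ α p v _ _)
  where
    p≢e : ∀ t → p ≢ e t
    p≢e t = e≢p t ∘ sym
    e′ : Fin (size β) → Fin (size α)
    e′ t = punchOut (p≢e t)

-- Closure under containment

DownClosed : Class → Set
DownClosed X = ∀ ρ π → ρ ≼ π → X π → X ρ

DeleteClosed : Class → Set
DeleteClosed X = ∀ ρ p → X ρ → X (delete ρ p)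

IsoClosed : Class → Set
IsoClosed X = ∀ {n} {f g : Fin n → Fin n}
              (f-inj : ∀ {i j} → f i ≡ f j → i ≡ j) (g-inj : ∀ {i j} → g i ≡ g j → i ≡ j) →
              (∀ i j → f i Fin.< f j ⇔ g i Fin.< g j) → X (perm n g g-inj) → X (perm n f f-inj)

≼-delete : ∀ {ρ π} ((e , _) : ρ ≼ π) j → (∀ i → e i ≢ j) → ρ ≼ delete π j
≼-delete {π = π} (e , e-inc , e-iso) j e≢j =
  (λ i → keptIndex π j (e i) (e≢j i)) ,
  (λ a b a<b → D.keptIndex-mono-< _ _ _ _ (e-inc a b a<b)) ,
  (λ a b → e-iso a b ⟨⇔⟩ D.keptIndex-<-⇔ _ _ _ _)
  where module D = Delete π j

module _ {X : Class} (X-delete : DeleteClosed X) (X-iso : IsoClosed X) where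

  private
    ≼-surjective⇒size≥ : ∀ {ρ π} ((e , _) : ρ ≼ π) → (∀ j → ∃[ i ] e i ≡ j) → size π ℕ.≤ size ρ
    ≼-surjective⇒size≥ (e , _) onto =
      FP.injective⇒≤ {f = proj₁ ∘ onto} λ {j} {j′} eq →
        trans (sym (proj₂ (onto j))) (trans (cong e eq) (proj₂ (onto j′)))

    sameSizeEmbedding : ∀ {a} {f g : Fin a → Fin a}
               (f-inj : ∀ {i j} → f i ≡ f j → i ≡ j) (g-inj : ∀ {i j} → g i ≡ g j → i ≡ j) →
               perm a f f-inj ≼ perm a g g-inj → X (perm a g g-inj) → X (perm a f f-inj)
    sameSizeEmbedding {g = g} f-inj g-inj (e , e-inc , e-iso) = X-iso f-inj g-inj λ i j →
      e-iso i j ⟨⇔⟩ <-resp-≡-⇔ (cong g (strictlyIncreasing⇒≗id e-inc i)) (cong g (strictlyIncreasing⇒≗id e-inc j))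

    surjectiveEmbedding : ∀ {ρ π} ((e , _) : ρ ≼ π) → (∀ j → ∃[ i ] e i ≡ j) → X π → X ρ
    surjectiveEmbedding {ρ@(perm a f f-inj)} {π@(perm b g g-inj)} ρ≼π onto
      with ℕP.≤-antisym (≼⇒size≤ {ρ} {π} ρ≼π) (≼-surjective⇒size≥ {ρ} {π} ρ≼π onto)
    ... | refl = sameSizeEmbedding f-inj g-inj ρ≼π

    bySize : ∀ n {ρ π} → size π ≡ n → ρ ≼ π → X π → X ρ
    bySize n {ρ} {π} size≡n ρ≼π@(e , _) xπ with FP.all? (λ j → FP.any? (λ i → e i FP.≟ j))
    ... | yes onto = surjectiveEmbedding {ρ} {π} ρ≼π onto xπ
    ... | no ¬onto with FP.¬∀⟶∃¬ _ _ (λ j → FP.any? (λ i → e i FP.≟ j)) ¬onto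
    ...   | j , j∉e with n
    ...     | zero = ⊥-elim (FP.¬Fin0 (subst Fin size≡n j))
    ...     | suc n′ = bySize n′ (ℕP.suc-injective (trans (suc-size-delete π j) size≡n))
                         (≼-delete {ρ} {π} ρ≼π j (λ i eq → j∉e (i , eq))) (X-delete π j xπ)

  deleteClosed∧isoClosed⇒downClosed : DownClosed X
  deleteClosed∧isoClosed⇒downClosed ρ π = bySize _ {ρ} {π} refl

module DeleteFromInflation {C E : Class} (C-closed : DownClosed C) (E-closed : DownClosed E)
                           {π : Perm} (J : Inflation C E π) (p : Fin (size π)) where
  open Inflation J

  private
    module Dπ = Delete π p
    π′ : Perm
    π′ = delete π p
    c : Fin (size σ)
    c = block p
    kπ : Fin (size π′) → Fin (size π)
    kπ = kept π p

  module SharedBlock (i₀ : Fin (size π′)) (i₀∈c : block (kπ i₀) ≡ c) where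

    private
      t₀ : Fin (size (τ c))
      t₀ = proj₁ (emb-onto c p refl)
      emb-t₀ : emb c t₀ ≡ p
      emb-t₀ = proj₂ (emb-onto c p refl)
      kτ : Fin (size (delete (τ c) t₀)) → Fin (size (τ c))
      kτ = kept (τ c) t₀

      emb-kept≢p : ∀ s → emb c (kτ s) ≢ p
      emb-kept≢p s eq = kept-≢ (τ c) t₀ s (StrictlyIncreasing.injective (emb-incr c) (trans eq (sym emb-t₀)))

      emb≢p : ∀ d → c ≢ d → ∀ s → emb d s ≢ p
      emb≢p d c≢d s eq = c≢d (trans (cong block (sym eq)) (emb-in d s))

    block′ : Fin (size π′) → Fin (size σ)
    block′ i = block (kπ i)

    τ′ : Fin (size σ) → Perm
    τ′ d with c FP.≟ d
    ... | yes refl = delete (τ c) t₀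
    ... | no _ = τ d

    τ′∈E : ∀ d → E (τ′ d)
    τ′∈E d with c FP.≟ d
    ... | yes refl = E-closed _ _ (delete-≼ (τ c) t₀) (τ∈E c)
    ... | no _ = τ∈E d

    emb′ : ∀ d → Fin (size (τ′ d)) → Fin (size π′)
    emb′ d with c FP.≟ d
    ... | yes refl = λ s → keptIndex π p (emb c (kτ s)) (emb-kept≢p s)
    ... | no c≢d = λ s → keptIndex π p (emb d s) (emb≢p d c≢d s)

    emb′-incr : ∀ d t u → t Fin.< u → emb′ d t Fin.< emb′ d u
    emb′-incr d with c FP.≟ d
    ... | yes refl = λ t u t<u → Dπ.keptIndex-mono-< _ _ _ _ (emb-incr c _ _ (kept-inc (τ c) t₀ t u t<u))
    ... | no _ = λ t u t<u → Dπ.keptIndex-mono-< _ _ _ _ (emb-incr d _ _ t<u)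

    emb′-in : ∀ d t → block′ (emb′ d t) ≡ d
    emb′-in d with c FP.≟ d
    ... | yes refl = λ t → trans (cong block (kept-keptIndex π p _ _)) (emb-in c _)
    ... | no _ = λ t → trans (cong block (kept-keptIndex π p _ _)) (emb-in d _)

    emb′-onto : ∀ d i → block′ i ≡ d → ∃[ t ] emb′ d t ≡ i
    emb′-onto d with c FP.≟ d
    ... | yes refl = λ i i∈c →
      let (t , emb-t) = emb-onto c (kπ i) i∈c
          t≢t₀ : t ≢ t₀
          t≢t₀ = λ t≡t₀ → kept-≢ π p i (trans (sym emb-t) (trans (cong (emb c) t≡t₀) emb-t₀))
      in keptIndex (τ c) t₀ t t≢t₀ ,
         Dπ.injective (trans (kept-keptIndex π p _ _)
                        (trans (cong (emb c) (kept-keptIndex (τ c) t₀ t t≢t₀)) emb-t))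
    ... | no _ = λ i i∈d →
      let (t , emb-t) = emb-onto d (kπ i) i∈d
      in t , Dπ.injective (trans (kept-keptIndex π p _ _) emb-t)

    emb′-iso : ∀ d t u → (fun (τ′ d) t Fin.< fun (τ′ d) u) ⇔ (fun π′ (emb′ d t) Fin.< fun π′ (emb′ d u))
    emb′-iso d with c FP.≟ d
    ... | yes refl = λ t u → delete-<-⇔ (τ c) t₀ t u ⟨⇔⟩ emb-iso c _ _ ⟨⇔⟩ Dπ.keptIndex-<-⇔ _ _ _ _
    ... | no _ = λ t u → emb-iso d t u ⟨⇔⟩ Dπ.keptIndex-<-⇔ _ _ _ _

    block′-surjective : ∀ d → ∃[ i ] block′ i ≡ d
    block′-surjective d with surj d
    ... | k , k∈d with k FP.≟ p
    ...   | yes refl = i₀ , trans i₀∈c k∈d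
    ...   | no k≢p = keptIndex π p k k≢p , trans (cong block (kept-keptIndex π p k k≢p)) k∈d

    result : Inflation C E π′
    result = record
      { σ = σ ; σ∈C = σ∈C ; block = block′
      ; mono = λ i j i≤j → mono _ _ (Dπ.mono-≤ i≤j)
      ; surj = block′-surjective
      ; cross = λ i j ne → delete-<-⇔ π p i j ⟨⇔⟩ cross (kπ i) (kπ j) ne
      ; τ = τ′ ; τ∈E = τ′∈E ; emb = emb′ ; emb-incr = emb′-incr ; emb-in = emb′-in
      ; emb-onto = emb′-onto ; emb-iso = emb′-iso }

  module SingletonBlock (alone : ∀ i → block (kπ i) ≢ c) where

    private
      module Dσ = Delete σ c
      kσ : Fin (size (delete σ c)) → Fin (size σ)
      kσ = kept σ c

      block′ : Fin (size π′) → Fin (size (delete σ c))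
      block′ i = keptIndex σ c (block (kπ i)) (alone i)

      kept-block′ : ∀ i → kσ (block′ i) ≡ block (kπ i)
      kept-block′ i = kept-keptIndex σ c _ _

      emb≢p : ∀ d s → emb (kσ d) s ≢ p
      emb≢p d s eq = kept-≢ σ c d (sym (trans (cong block (sym eq)) (emb-in (kσ d) s)))

      emb′ : ∀ d → Fin (size (τ (kσ d))) → Fin (size π′)
      emb′ d s = keptIndex π p (emb (kσ d) s) (emb≢p d s)

      block′-surjective : ∀ d → ∃[ i ] block′ i ≡ d
      block′-surjective d with surj (kσ d)
      ... | k , k∈d with k FP.≟ p
      ...   | yes refl = ⊥-elim (kept-≢ σ c d (sym k∈d))
      ...   | no k≢p = i , Dσ.injective (trans (kept-block′ i) (trans (cong block (kept-keptIndex π p k k≢p)) k∈d))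
        where i = keptIndex π p k k≢p

    result : Inflation C E π′
    result = record
      { σ = delete σ c ; σ∈C = C-closed _ _ (delete-≼ σ c) σ∈C ; block = block′
      ; mono = λ i j i≤j → Dσ.cancel-≤ (subst₂ Fin._≤_ (sym (kept-block′ i)) (sym (kept-block′ j)) (mono _ _ (Dπ.mono-≤ i≤j)))
      ; surj = block′-surjective
      ; cross = λ i j ne → delete-<-⇔ π p i j ⟨⇔⟩
                           cross (kπ i) (kπ j) (ne ∘ Dσ.keptIndex-cong _ _ _ _) ⟨⇔⟩
                           Dσ.keptIndex-<-⇔ _ _ _ _
      ; τ = λ d → τ (kσ d) ; τ∈E = λ d → τ∈E (kσ d) ; emb = emb′
      ; emb-incr = λ d t u t<u → Dπ.keptIndex-mono-< _ _ _ _ (emb-incr (kσ d) t u t<u)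
      ; emb-in = λ d t → Dσ.injective (trans (kept-block′ _) (trans (cong block (kept-keptIndex π p _ _)) (emb-in (kσ d) t)))
      ; emb-onto = λ d i i∈d →
          let (t , emb-t) = emb-onto (kσ d) (kπ i) (trans (sym (kept-block′ i)) (cong kσ i∈d))
          in t , Dπ.injective (trans (kept-keptIndex π p _ _) emb-t)
      ; emb-iso = λ d t u → emb-iso (kσ d) t u ⟨⇔⟩ Dπ.keptIndex-<-⇔ _ _ _ _ }

  result : Inflation C E π′
  result with FP.any? (λ i → block (kπ i) FP.≟ c)
  ... | yes (i₀ , i₀∈c) = SharedBlock.result i₀ i₀∈c
  ... | no alone = SingletonBlock.result (λ i i∈c → alone (i , i∈c))

Inflation-downClosed : ∀ {C E} → DownClosed C → DownClosed E → DownClosed (C [ E ])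
Inflation-downClosed C-closed E-closed = deleteClosed∧isoClosed⇒downClosed
  (λ π p J → DeleteFromInflation.result C-closed E-closed J p)
  (λ f-inj g-inj f≅g J → let open Inflation J in record
     { σ = σ ; σ∈C = σ∈C ; block = block ; mono = mono ; surj = surj
     ; cross = λ i j ne → f≅g i j ⟨⇔⟩ cross i j ne
     ; τ = τ ; τ∈E = τ∈E ; emb = emb ; emb-incr = emb-incr ; emb-in = emb-in ; emb-onto = emb-onto
     ; emb-iso = λ c t u → emb-iso c t u ⟨⇔⟩ ⇔-sym (f≅g _ _) })

Av-downClosed : ∀ β → DownClosed (Av β)
Av-downClosed β ρ π ρ≼π β⋠π β≼ρ = β⋠π (≼-trans {β} {ρ} {π} β≼ρ ρ≼π)

Incr-downClosed : DownClosed Incr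
Incr-downClosed ρ π (e , e-inc , e-iso) π-id = strictlyIncreasing⇒≗id ρ-inc
  where
    ρ-inc : StrictlyIncreasing (fun ρ)
    ρ-inc i j i<j = from (e-iso i j) (subst₂ Fin._<_ (sym (π-id (e i))) (sym (π-id (e j))) (e-inc i j i<j))

Decr-downClosed : DownClosed Decr
Decr-downClosed ρ π (e , e-inc , e-iso) π-opp i =
  trans (sym (FP.opposite-involutive (fun ρ i))) (cong opposite (strictlyIncreasing⇒≗id ρ-inc i))
  where
    ρ-inc : StrictlyIncreasing (opposite ∘ fun ρ)
    ρ-inc i j i<j = opposite-anti-<
      (from (e-iso j i) (subst₂ Fin._<_ (sym (π-opp (e j))) (sym (π-opp (e i))) (opposite-anti-< (e-inc i j i<j))))

letterClass-downClosed : ∀ a → DownClosed (letterClass a)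
letterClass-downClosed I = Incr-downClosed
letterClass-downClosed D = Decr-downClosed
letterClass-downClosed A213 = Av-downClosed p213
letterClass-downClosed A312 = Av-downClosed p312
letterClass-downClosed A132 = Av-downClosed p132
letterClass-downClosed A231 = Av-downClosed p231

⟦⟧-downClosed : ∀ w → DownClosed ⟦ w ⟧
⟦⟧-downClosed [] ρ π ρ≼π size≤1 = ℕP.≤-trans (≼⇒size≤ {ρ} {π} ρ≼π) size≤1
⟦⟧-downClosed (a ∷ w) = Inflation-downClosed (letterClass-downClosed a) (⟦⟧-downClosed w)

onePoint : Perm
onePoint = perm 1 (λ _ → zero) (λ { {zero} {zero} _ → refl })

trivialInflation : ∀ {C E : Class} {π} → C onePoint → E π → Fin (size π) → Inflation C E π
trivialInflation {π = π} one∈C π∈E i₀ = record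
  { σ = onePoint ; σ∈C = one∈C ; block = λ _ → zero ; mono = λ _ _ _ → z≤n
  ; surj = λ { zero → i₀ , refl }
  ; cross = λ i j ne → ⊥-elim (ne refl)
  ; τ = λ _ → π ; τ∈E = λ _ → π∈E ; emb = λ _ t → t ; emb-incr = λ _ _ _ t<u → t<u
  ; emb-in = λ { zero t → refl }
  ; emb-onto = λ c i _ → i , refl
  ; emb-iso = λ _ _ _ → ⇔-id _ }

<-size⇒⋠ : ∀ β π → size π ℕ.< size β → ¬ (β ≼ π)
<-size⇒⋠ β π π<β β≼π = ℕP.<⇒≱ π<β (≼⇒size≤ {β} {π} β≼π)

letterClass-onePoint : ∀ a → letterClass a onePoint
letterClass-onePoint I zero = refl
letterClass-onePoint D zero = refl
letterClass-onePoint A213 = <-size⇒⋠ p213 onePoint (s≤s (s≤s z≤n))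
letterClass-onePoint A312 = <-size⇒⋠ p312 onePoint (s≤s (s≤s z≤n))
letterClass-onePoint A132 = <-size⇒⋠ p132 onePoint (s≤s (s≤s z≤n))
letterClass-onePoint A231 = <-size⇒⋠ p231 onePoint (s≤s (s≤s z≤n))

⟦⟧-onePoint : ∀ w → ⟦ w ⟧ onePoint
⟦⟧-onePoint [] = s≤s z≤n
⟦⟧-onePoint (a ∷ w) = trivialInflation (letterClass-onePoint a) (⟦⟧-onePoint w) zero

-- The new point (p, v) of π becomes a singleton block over the new point (q, w) of the skeleton.
module InsertSingletonBlock {C E : Class} {π : Perm} (J : Inflation C E π)
  (p v : Fin (suc (size π))) (q w : Fin (suc (size (Inflation.σ J))))
  (left  : ∀ i → punchIn p i Fin.< p → punchIn q (Inflation.block J i) Fin.< q)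
  (right : ∀ i → p Fin.< punchIn p i → q Fin.< punchIn q (Inflation.block J i))
  (above : ∀ i → (v Fin.< punchIn v (fun π i)) ⇔
                 (w Fin.< punchIn w (fun (Inflation.σ J) (Inflation.block J i))))
  (below : ∀ i → (punchIn v (fun π i) Fin.< v) ⇔
                 (punchIn w (fun (Inflation.σ J) (Inflation.block J i)) Fin.< w))
  (skeleton∈C : C (insert (Inflation.σ J) q w)) (one∈E : E onePoint) where

  open Inflation J

  private
    π′ σ′ : Perm
    π′ = insert π p v
    σ′ = insert σ q w

    block′ : Fin (suc (size π)) → Fin (suc (size σ))
    block′ j with insertView p j
    ... | at = q
    ... | punched i = punchIn q (block i)

    block′-at : block′ p ≡ q
    block′-at rewrite insertView-at p = refl

    block′-punchIn : ∀ i → block′ (punchIn p i) ≡ punchIn q (block i)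
    block′-punchIn i rewrite insertView-punched p i = refl

    mono′ : ∀ j k → j Fin.≤ k → block′ j Fin.≤ block′ k
    mono′ j k j≤k with insertView p j | insertView p k
    ... | at        | at         = ℕP.≤-refl
    ... | at        | punched i  = ℕP.<⇒≤ (right i (FP.≤∧≢⇒< j≤k (FP.punchInᵢ≢i p i ∘ sym)))
    ... | punched i | at         = ℕP.<⇒≤ (left i (FP.≤∧≢⇒< j≤k (FP.punchInᵢ≢i p i)))
    ... | punched i | punched i′ = PunchIn.mono-≤ q (mono _ _ (PunchIn.cancel-≤ p j≤k))

    surj′ : ∀ d → ∃[ j ] block′ j ≡ d
    surj′ d with insertView q d
    ... | at = p , block′-at
    ... | punched d′ = punchIn p (proj₁ (surj d′)) , trans (block′-punchIn _) (cong (punchIn q) (proj₂ (surj d′)))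

    σ′-at : fun σ′ q ≡ w
    σ′-at = insertFun-at (fun σ) q w

    σ′-punchIn : ∀ d → fun σ′ (punchIn q d) ≡ punchIn w (fun σ d)
    σ′-punchIn = insertFun-punchIn (fun σ) q w

    cross′ : ∀ j k → ¬ (block′ j ≡ block′ k) →
             (fun π′ j Fin.< fun π′ k) ⇔ (fun σ′ (block′ j) Fin.< fun σ′ (block′ k))
    cross′ j k ne with insertView p j | insertView p k
    ... | at        | at         = ⊥-elim (ne refl)
    ... | at        | punched i  = above i ⟨⇔⟩ <-resp-≡-⇔ (sym σ′-at) (sym (σ′-punchIn _))
    ... | punched i | at         = below i ⟨⇔⟩ <-resp-≡-⇔ (sym (σ′-punchIn _)) (sym σ′-at)
    ... | punched i | punched i′ =
      ⇔-sym (PunchIn.<-⇔ v _ _) ⟨⇔⟩ cross i i′ (ne ∘ cong (punchIn q)) ⟨⇔⟩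
      PunchIn.<-⇔ w _ _ ⟨⇔⟩ <-resp-≡-⇔ (sym (σ′-punchIn _)) (sym (σ′-punchIn _))

    τ′ : Fin (suc (size σ)) → Perm
    τ′ d with insertView q d
    ... | at = onePoint
    ... | punched d′ = τ d′

    τ′∈E : ∀ d → E (τ′ d)
    τ′∈E d with insertView q d
    ... | at = one∈E
    ... | punched d′ = τ∈E d′

    emb′ : ∀ d → Fin (size (τ′ d)) → Fin (suc (size π))
    emb′ d with insertView q d
    ... | at = λ _ → p
    ... | punched d′ = λ t → punchIn p (emb d′ t)

    emb′-incr : ∀ d t u → t Fin.< u → emb′ d t Fin.< emb′ d u
    emb′-incr d with insertView q d
    ... | at = λ { zero zero () }
    ... | punched d′ = λ t u t<u → punchIn-mono-< p _ _ (emb-incr d′ t u t<u)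

    emb′-in : ∀ d t → block′ (emb′ d t) ≡ d
    emb′-in d with insertView q d
    ... | at = λ _ → block′-at
    ... | punched d′ = λ t → trans (block′-punchIn _) (cong (punchIn q) (emb-in d′ t))

    emb′-onto : ∀ d j → block′ j ≡ d → ∃[ t ] emb′ d t ≡ j
    emb′-onto d j j∈d with insertView q d | insertView p j
    ... | at        | at        = zero , refl
    ... | at        | punched i = ⊥-elim (FP.punchInᵢ≢i q (block i) j∈d)
    ... | punched d′ | at       = ⊥-elim (FP.punchInᵢ≢i q d′ (sym j∈d))
    ... | punched d′ | punched i =
      let (t , emb-t) = emb-onto d′ i (FP.punchIn-injective q _ _ j∈d) in t , cong (punchIn p) emb-t

    emb′-iso : ∀ d t u → (fun (τ′ d) t Fin.< fun (τ′ d) u) ⇔ (fun π′ (emb′ d t) Fin.< fun π′ (emb′ d u))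
    emb′-iso d with insertView q d
    ... | at = λ { zero zero → mk⇔ (λ ()) (λ lt → ⊥-elim (FP.<-irrefl refl lt)) }
    ... | punched d′ = λ t u → emb-iso d′ t u ⟨⇔⟩ insert-<-⇔ π p v _ _

  result : Inflation C E π′
  result = record
    { σ = σ′ ; σ∈C = skeleton∈C ; block = block′ ; mono = mono′ ; surj = surj′ ; cross = cross′
    ; τ = τ′ ; τ∈E = τ′∈E ; emb = emb′ ; emb-incr = emb′-incr ; emb-in = emb′-in
    ; emb-onto = emb′-onto ; emb-iso = emb′-iso }

-- Sum-indecomposable covers

toℕ-punchIn-fromℕ : ∀ {n} (i : Fin n) → toℕ (punchIn (fromℕ n) i) ≡ toℕ i
toℕ-punchIn-fromℕ {suc n} zero = refl
toℕ-punchIn-fromℕ {suc n} (suc i) = cong suc (toℕ-punchIn-fromℕ i)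

punchIn-fromℕ-< : ∀ {n} (i : Fin n) → punchIn (fromℕ n) i Fin.< fromℕ n
punchIn-fromℕ-< {n} i rewrite toℕ-punchIn-fromℕ i | FP.toℕ-fromℕ n = FP.toℕ<n i

fromℕ-≮ : ∀ {n} (j : Fin (suc n)) → ¬ (fromℕ n Fin.< j)
fromℕ-≮ j = ℕP.≤⇒≯ (FP.≤fromℕ j)

appendMin : Perm → Perm
appendMin α = insert α (fromℕ (size α)) zero

prependMax : Perm → Perm
prependMax α = insert α zero (fromℕ (size α))

Av-appendMin : ∀ β α (x y : Fin (size β)) → (∀ t → t Fin.≤ y) → fun β x Fin.< fun β y →
               Av β α → Av β (appendMin α)
Av-appendMin β α x y y-last βx<βy β⋠α β≼@(e , e-inc , e-iso) =
  β⋠α (≼-insert⁻ {β} {α} β≼ e≢last)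
  where
    last : Fin (suc (size α))
    last = fromℕ (size α)
    ey≢last : e y ≢ last
    ey≢last ey≡last = ℕP.n≮0
      (subst (fun (appendMin α) (e x) Fin.<_)
             (trans (cong (fun (appendMin α)) ey≡last) (insertFun-at (fun α) last zero))
             (to (e-iso x y) βx<βy))
    e≢last : ∀ t → e t ≢ last
    e≢last t et≡last = ey≢last (FP.≤-antisym (FP.≤fromℕ (e y))
      (subst (Fin._≤ e y) et≡last (StrictlyIncreasing.mono-≤ e-inc (y-last t))))

Av-prependMax : ∀ β α (x y : Fin (size β)) → (∀ t → x Fin.≤ t) → fun β x Fin.< fun β y →
                Av β α → Av β (prependMax α)
Av-prependMax β α x y x-first βx<βy β⋠α β≼@(e , e-inc , e-iso) =
  β⋠α (≼-insert⁻ {β} {α} β≼ e≢first)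
  where
    ex≢first : e x ≢ zero
    ex≢first ex≡first = fromℕ-≮ _
      (subst (Fin._< fun (prependMax α) (e y))
             (trans (cong (fun (prependMax α)) ex≡first) (insertFun-at (fun α) zero (fromℕ (size α))))
             (to (e-iso x y) βx<βy))
    e≢first : ∀ t → e t ≢ zero
    e≢first t et≡first = ex≢first (FP.≤-antisym
      (subst (e x Fin.≤_) et≡first (StrictlyIncreasing.mono-≤ e-inc (x-first t))) z≤n)

Decr-appendMin : ∀ α → Decr α → Decr (appendMin α)
Decr-appendMin α α-decr j with insertView (fromℕ (size α)) j
... | at = FP.toℕ-injective (sym (begin
      toℕ (opposite (fromℕ n))   ≡⟨ FP.opposite-prop (fromℕ n) ⟩
      n ℕ.∸ toℕ (fromℕ n)        ≡⟨ cong (n ℕ.∸_) (FP.toℕ-fromℕ n) ⟩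
      n ℕ.∸ n                    ≡⟨ ℕP.n∸n≡0 n ⟩
      0                          ∎))
  where
    open ≡-Reasoning
    n : ℕ
    n = size α
... | punched i = FP.toℕ-injective (begin
      suc (toℕ (fun α i))                    ≡⟨ cong (suc ∘ toℕ) (α-decr i) ⟩
      suc (toℕ (opposite i))                 ≡⟨ cong suc (FP.opposite-prop i) ⟩
      suc (n ℕ.∸ suc (toℕ i))                ≡⟨ sym (ℕP.+-∸-assoc 1 (FP.toℕ<n i)) ⟩
      n ℕ.∸ toℕ i                            ≡⟨ cong (n ℕ.∸_) (sym (toℕ-punchIn-fromℕ i)) ⟩
      n ℕ.∸ toℕ (punchIn (fromℕ n) i)        ≡⟨ sym (FP.opposite-prop (punchIn (fromℕ n) i)) ⟩
      toℕ (opposite (punchIn (fromℕ n) i))   ∎)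
  where
    open ≡-Reasoning
    n : ℕ
    n = size α

data AppendMinLetter : Letter → Set where
  D    : AppendMinLetter D
  A213 : AppendMinLetter A213
  A312 : AppendMinLetter A312
  A132 : AppendMinLetter A132

letterClass-appendMin : ∀ {a} → AppendMinLetter a → ∀ α → letterClass a α → letterClass a (appendMin α)
letterClass-appendMin D    α = Decr-appendMin α
letterClass-appendMin A213 α = Av-appendMin p213 α zero (fromℕ 2) FP.≤fromℕ (s≤s (s≤s z≤n))
letterClass-appendMin A312 α = Av-appendMin p312 α (suc zero) (fromℕ 2) FP.≤fromℕ (s≤s z≤n)
letterClass-appendMin A132 α = Av-appendMin p132 α zero (fromℕ 2) FP.≤fromℕ (s≤s z≤n)

Av231-prependMax : ∀ α → Av p231 α → Av p231 (prependMax α)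
Av231-prependMax α = Av-prependMax p231 α zero (suc zero) (λ _ → z≤n) (s≤s (s≤s z≤n))

appendMin-indecomposable : ∀ π → SumIndecomposable (appendMin π)
appendMin-indecomposable π = s≤s z≤n , λ { (m , 0<m , m<n+1 , split) → ℕP.n≮0
  (subst (fun (appendMin π) zero Fin.<_) (insertFun-at (fun π) (fromℕ n) zero)
         (split zero (fromℕ n) 0<m (subst (m ℕ.≤_) (sym (FP.toℕ-fromℕ n)) (ℕP.≤-pred m<n+1)))) }
  where
    n : ℕ
    n = size π

prependMax-indecomposable : ∀ π → SumIndecomposable (prependMax π)
prependMax-indecomposable π = s≤s z≤n , λ { (m , 0<m , m<n+1 , split) → fromℕ-≮ _
  (subst (Fin._< fun (prependMax π) (fromℕ n)) (insertFun-at (fun π) zero (fromℕ n))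
         (split zero (fromℕ n) 0<m (subst (m ℕ.≤_) (sym (FP.toℕ-fromℕ n)) (ℕP.≤-pred m<n+1)))) }
  where
    n : ℕ
    n = size π

onePoint-indecomposable : SumIndecomposable onePoint
onePoint-indecomposable = s≤s z≤n , λ { (m , 0<m , m<1 , _) → ℕP.<⇒≱ 0<m (ℕP.≤-pred m<1) }

≼onePoint : ∀ π → size π ℕ.≤ 1 → π ≼ onePoint
≼onePoint (perm zero _ _) _ = (λ ()) , (λ ()) , (λ ())
≼onePoint (perm (suc zero) f _) _ =
  (λ _ → zero) , (λ { zero zero () }) , (λ { zero zero → mk⇔ (λ lt → ⊥-elim (FP.<-irrefl refl lt)) (λ ()) })
≼onePoint (perm (suc (suc _)) _ _) (s≤s ())

appendMin-⟦⟧ : ∀ {a} → AppendMinLetter a → ∀ w π → ⟦ a ∷ w ⟧ π → ⟦ a ∷ w ⟧ (appendMin π)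
appendMin-⟦⟧ a w π π∈X = InsertSingletonBlock.result π∈X (fromℕ (size π)) zero (fromℕ (size σ)) zero
  (λ i _ → punchIn-fromℕ-< (block i))
  (λ i last<i → ⊥-elim (fromℕ-≮ _ last<i))
  (λ i → mk⇔ (λ _ → s≤s z≤n) (λ _ → s≤s z≤n))
  (λ i → mk⇔ (λ ()) (λ ()))
  (letterClass-appendMin a σ σ∈C) (⟦⟧-onePoint w)
  where open Inflation π∈X

prependMax-⟦⟧ : ∀ w π → ⟦ A231 ∷ w ⟧ π → ⟦ A231 ∷ w ⟧ (prependMax π)
prependMax-⟦⟧ w π π∈X = InsertSingletonBlock.result π∈X zero (fromℕ (size π)) zero (fromℕ (size σ))
  (λ i ())
  (λ i _ → s≤s z≤n)
  (λ i → mk⇔ (⊥-elim ∘ fromℕ-≮ _) (⊥-elim ∘ fromℕ-≮ _))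
  (λ i → mk⇔ (λ _ → punchIn-fromℕ-< _) (λ _ → punchIn-fromℕ-< _))
  (Av231-prependMax σ σ∈C) (⟦⟧-onePoint w)
  where open Inflation π∈X

IndecomposableCover : Class → Perm → Set
IndecomposableCover X π = ∃[ σ ] (SumIndecomposable σ × π ≼ σ × X σ)

appendMinCover : ∀ {a} → AppendMinLetter a → ∀ w π → ⟦ a ∷ w ⟧ π → IndecomposableCover ⟦ a ∷ w ⟧ π
appendMinCover a w π π∈X = appendMin π , appendMin-indecomposable π , ≼-insert π (fromℕ (size π)) zero , appendMin-⟦⟧ a w π π∈X

⟦⟧-indecomposableCover : ∀ x → Reduced (A213 ∷ x) → ∀ π → ⟦ x ⟧ π → IndecomposableCover ⟦ x ⟧ π
⟦⟧-indecomposableCover [] _ π size≤1 = onePoint , onePoint-indecomposable , ≼onePoint π size≤1 , s≤s z≤n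
⟦⟧-indecomposableCover (I ∷ w) (A213I-forbidden , _) π _ = ⊥-elim (A213I-forbidden tt)
⟦⟧-indecomposableCover (D ∷ w) _ = appendMinCover D w
⟦⟧-indecomposableCover (A213 ∷ w) _ = appendMinCover A213 w
⟦⟧-indecomposableCover (A312 ∷ w) _ = appendMinCover A312 w
⟦⟧-indecomposableCover (A132 ∷ w) _ = appendMinCover A132 w
⟦⟧-indecomposableCover (A231 ∷ w) _ π π∈X =
  prependMax π , prependMax-indecomposable π , ≼-insert π zero (fromℕ (size π)) , prependMax-⟦⟧ w π π∈X

-- Blocks of σ ⊕ 1

data ⊕1View {n} : Fin (n ℕ.+ 1) → Set where
  left  : (i : Fin n) → ⊕1View (i ↑ˡ 1)
  right : ⊕1View (n ↑ʳ zero)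

⊕1view : ∀ {n} (j : Fin (n ℕ.+ 1)) → ⊕1View j
⊕1view {zero} zero = right
⊕1view {suc n} zero = left zero
⊕1view {suc n} (suc j) with ⊕1view j
... | left i = left (suc i)
... | right = right

toℕ-↑ʳzero : ∀ n → toℕ (n ↑ʳ (Fin 1 ∋ zero)) ≡ n
toℕ-↑ʳzero n = trans (FP.toℕ-↑ʳ n zero) (ℕP.+-identityʳ n)

toℕ-⊕1-left : ∀ σ i → toℕ (fun (σ ⊕1) (i ↑ˡ 1)) ≡ toℕ (fun σ i)
toℕ-⊕1-left σ i =
  trans (cong (toℕ ∘ Fin.join (size σ) 1 ∘ Sum.map₁ (fun σ)) (FP.splitAt-↑ˡ (size σ) i 1)) (FP.toℕ-↑ˡ _ 1)

toℕ-⊕1-right : ∀ σ → toℕ (fun (σ ⊕1) (size σ ↑ʳ zero)) ≡ size σ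
toℕ-⊕1-right σ =
  trans (cong (toℕ ∘ Fin.join (size σ) 1 ∘ Sum.map₁ (fun σ)) (FP.splitAt-↑ʳ (size σ) 1 zero)) (toℕ-↑ʳzero (size σ))

⊕1≼insert : ∀ σ → (σ ⊕1) ≼ insert σ (fromℕ (size σ)) (fromℕ (size σ))
⊕1≼insert σ = e , (λ i j i<j → to (<-resp-toℕ-⇔ (sym (FP.toℕ-cast _ i)) (sym (FP.toℕ-cast _ j))) i<j) ,
              λ i j → <-resp-toℕ-⇔ (same-value i) (same-value j)
  where
    n : ℕ
    n = size σ
    e : Fin (n ℕ.+ 1) → Fin (suc n)
    e = Fin.cast (ℕP.+-comm n 1)
    same-value : ∀ j → toℕ (fun (σ ⊕1) j) ≡ toℕ (fun (insert σ (fromℕ n) (fromℕ n)) (e j))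
    same-value j with ⊕1view j
    ... | left i = begin
      toℕ (fun (σ ⊕1) (i ↑ˡ 1))                                   ≡⟨ toℕ-⊕1-left σ i ⟩
      toℕ (fun σ i)                                                ≡⟨ sym (toℕ-punchIn-fromℕ (fun σ i)) ⟩
      toℕ (punchIn (fromℕ n) (fun σ i))                            ≡⟨ cong toℕ (sym (insertFun-punchIn (fun σ) (fromℕ n) (fromℕ n) i)) ⟩
      toℕ (fun (insert σ (fromℕ n) (fromℕ n)) (punchIn (fromℕ n) i)) ≡⟨ cong (toℕ ∘ fun (insert σ (fromℕ n) (fromℕ n))) e-left ⟩
      toℕ (fun (insert σ (fromℕ n) (fromℕ n)) (e (i ↑ˡ 1)))        ∎
      where
        open ≡-Reasoning
        e-left : punchIn (fromℕ n) i ≡ e (i ↑ˡ 1)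
        e-left = FP.toℕ-injective (trans (toℕ-punchIn-fromℕ i) (sym (trans (FP.toℕ-cast _ _) (FP.toℕ-↑ˡ i 1))))
    ... | right = begin
      toℕ (fun (σ ⊕1) (n ↑ʳ zero))                               ≡⟨ toℕ-⊕1-right σ ⟩
      n                                                          ≡⟨ sym (FP.toℕ-fromℕ n) ⟩
      toℕ (fromℕ n)                                              ≡⟨ cong toℕ (sym (insertFun-at (fun σ) (fromℕ n) (fromℕ n))) ⟩
      toℕ (fun (insert σ (fromℕ n) (fromℕ n)) (fromℕ n))         ≡⟨ cong (toℕ ∘ fun (insert σ (fromℕ n) (fromℕ n))) e-right ⟩
      toℕ (fun (insert σ (fromℕ n) (fromℕ n)) (e (n ↑ʳ zero)))   ∎
      where
        open ≡-Reasoning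
        e-right : fromℕ n ≡ e (n ↑ʳ zero)
        e-right = FP.toℕ-injective (trans (FP.toℕ-fromℕ n) (sym (trans (FP.toℕ-cast _ _) (toℕ-↑ʳzero n))))

-- σ is read as 1[σ]; the new maximum becomes a singleton block, turning the skeleton into 12.
⊕1∈Av213[] : ∀ {X} → DownClosed X → X onePoint → ∀ σ → 0 ℕ.< size σ → X σ → (Av p213 [ X ]) (σ ⊕1)
⊕1∈Av213[] {X} X-closed one∈X σ 0<n σ∈X =
  Inflation-downClosed (Av-downClosed p213) X-closed (σ ⊕1) (insert σ (fromℕ n) (fromℕ n)) (⊕1≼insert σ)
    (InsertSingletonBlock.result σ-as-1[σ] (fromℕ n) (fromℕ n) (fromℕ 1) (fromℕ 1)
      (λ i _ → s≤s z≤n)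
      (λ i last<i → ⊥-elim (fromℕ-≮ _ last<i))
      (λ i → mk⇔ (⊥-elim ∘ fromℕ-≮ _) (λ ()))
      (λ i → mk⇔ (λ _ → s≤s z≤n) (λ _ → punchIn-fromℕ-< _))
      (<-size⇒⋠ p213 (insert onePoint (fromℕ 1) (fromℕ 1)) ℕP.≤-refl) one∈X)
  where
    n : ℕ
    n = size σ
    σ-as-1[σ] : Inflation (Av p213) X σ
    σ-as-1[σ] = trivialInflation (letterClass-onePoint A213) σ∈X (Fin.fromℕ< 0<n)

213≼ : ∀ α (y₀ y₁ y₂ : Fin (size α)) → y₀ Fin.< y₁ → y₁ Fin.< y₂ →
       fun α y₁ Fin.< fun α y₀ → fun α y₀ Fin.< fun α y₂ → p213 ≼ α
213≼ α y₀ y₁ y₂ y₀<y₁ y₁<y₂ α₁<α₀ α₀<α₂ = e , e-inc , e-iso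
  where
    α₁<α₂ : fun α y₁ Fin.< fun α y₂
    α₁<α₂ = FP.<-trans α₁<α₀ α₀<α₂
    e : Fin 3 → Fin (size α)
    e zero = y₀
    e (suc zero) = y₁
    e (suc (suc zero)) = y₂
    e-inc : StrictlyIncreasing e
    e-inc zero (suc zero) _ = y₀<y₁
    e-inc zero (suc (suc zero)) _ = FP.<-trans y₀<y₁ y₁<y₂
    e-inc (suc zero) (suc (suc zero)) _ = y₁<y₂
    e-inc (suc zero) (suc zero) (s≤s ())
    e-inc (suc (suc zero)) (suc zero) (s≤s ())
    e-inc (suc (suc zero)) (suc (suc zero)) (s≤s (s≤s ()))
    irrefl : ∀ {y} → ¬ (fun α y Fin.< fun α y)
    irrefl = FP.<-irrefl refl
    e-iso : ∀ t u → (fun p213 t Fin.< fun p213 u) ⇔ (fun α (e t) Fin.< fun α (e u))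
    e-iso zero zero = mk⇔ (λ { (s≤s ()) }) (⊥-elim ∘ irrefl)
    e-iso zero (suc zero) = mk⇔ (λ ()) (⊥-elim ∘ FP.<-asym α₁<α₀)
    e-iso zero (suc (suc zero)) = mk⇔ (λ _ → α₀<α₂) (λ _ → s≤s (s≤s z≤n))
    e-iso (suc zero) zero = mk⇔ (λ _ → α₁<α₀) (λ _ → s≤s z≤n)
    e-iso (suc zero) (suc zero) = mk⇔ (λ ()) (⊥-elim ∘ irrefl)
    e-iso (suc zero) (suc (suc zero)) = mk⇔ (λ _ → α₁<α₂) (λ _ → s≤s z≤n)
    e-iso (suc (suc zero)) zero = mk⇔ (λ { (s≤s ()) }) (⊥-elim ∘ FP.<-asym α₀<α₂)
    e-iso (suc (suc zero)) (suc zero) = mk⇔ (λ ()) (⊥-elim ∘ FP.<-asym α₁<α₂)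
    e-iso (suc (suc zero)) (suc (suc zero)) = mk⇔ (λ { (s≤s (s≤s ())) }) (⊥-elim ∘ irrefl)

-- Let b be the block of the last entry ℓ of σ and i* the first position of σ in b.  Every
-- earlier entry lies in a block c < b and is below every entry from i* on: otherwise either
-- the appended maximum lies in b, and the skeleton order of c and b gives the opposite
-- comparison, or c, b and the block of the appended maximum form a 213 in the skeleton.
-- Indecomposability of σ then forces i* = 0, so all of σ lies in the block b.
module IndecomposableInOneBlock {X : Class} {σ : Perm} (J : Inflation (Av p213) X (σ ⊕1))
  (σ-indec : ¬ SumDecomposable σ) (ℓ : Fin (size σ)) (ℓ-last : suc (toℕ ℓ) ≡ size σ) where

  open Inflation J renaming (σ to α; σ∈C to α∈Av213)

  private
    n : ℕ
    n = size σ

    pos : Fin n → Fin (n ℕ.+ 1)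
    pos i = i ↑ˡ 1

    top : Fin (n ℕ.+ 1)
    top = n ↑ʳ zero

  b : Fin (size α)
  b = block (pos ℓ)

  private
    b⊤ : Fin (size α)
    b⊤ = block top

    toℕ≤ℓ : ∀ i → toℕ i ℕ.≤ toℕ ℓ
    toℕ≤ℓ i = ℕP.≤-pred (subst (toℕ i ℕ.<_) (sym ℓ-last) (FP.toℕ<n i))

    pos-mono-≤ : ∀ {i j} → toℕ i ℕ.≤ toℕ j → pos i Fin.≤ pos j
    pos-mono-≤ {i} {j} = subst₂ ℕ._≤_ (sym (FP.toℕ-↑ˡ i 1)) (sym (FP.toℕ-↑ˡ j 1))

    pos<top : ∀ i → pos i Fin.< top
    pos<top i = subst₂ ℕ._<_ (sym (FP.toℕ-↑ˡ i 1)) (sym (toℕ-↑ʳzero n)) (FP.toℕ<n i)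

    value-pos<top : ∀ i → fun (σ ⊕1) (pos i) Fin.< fun (σ ⊕1) top
    value-pos<top i = subst₂ ℕ._<_ (sym (toℕ-⊕1-left σ i)) (sym (toℕ-⊕1-right σ)) (FP.toℕ<n (fun σ i))

    value-pos-<-⇔ : ∀ i j → (fun σ i Fin.< fun σ j) ⇔ (fun (σ ⊕1) (pos i) Fin.< fun (σ ⊕1) (pos j))
    value-pos-<-⇔ i j = <-resp-toℕ-⇔ (sym (toℕ-⊕1-left σ i)) (sym (toℕ-⊕1-left σ j))

    firstInB : Σ (Fin n) λ i → ¬ (block (pos i) ≢ b) × ((j : Fin.Fin′ i) → block (pos (Fin.inject j)) ≢ b)
    firstInB = FP.¬∀⟶∃¬-smallest n (λ i → block (pos i) ≢ b) (λ i → ¬? (block (pos i) FP.≟ b)) (λ h → h ℓ refl)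
    i* : Fin n
    i* = proj₁ firstInB

    after : ∀ j → toℕ i* ℕ.≤ toℕ j → block (pos j) ≡ b
    after j i*≤j = FP.≤-antisym (mono (pos j) (pos ℓ) (pos-mono-≤ (toℕ≤ℓ j)))
      (subst (Fin._≤ block (pos j)) (decidable-stable (block (pos i*) FP.≟ b) (proj₁ (proj₂ firstInB)))
             (mono _ _ (pos-mono-≤ i*≤j)))

    before : ∀ j → toℕ j ℕ.< toℕ i* → block (pos j) ≢ b
    before j j<i* = subst (λ k → block (pos k) ≢ b) inject-j (proj₂ (proj₂ firstInB) (Fin.fromℕ< j<i*))
      where
        inject-j : Fin.inject (Fin.fromℕ< j<i*) ≡ j
        inject-j = FP.toℕ-injective (trans (FP.toℕ-inject (Fin.fromℕ< j<i*)) (FP.toℕ-fromℕ< j<i*))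

    separated : ∀ i j → toℕ i ℕ.< toℕ i* → toℕ i* ℕ.≤ toℕ j → fun σ i Fin.< fun σ j
    separated i j i<i* i*≤j with fun σ i FP.<? fun σ j
    ... | yes σi<σj = σi<σj
    ... | no σi≮σj = ⊥-elim (σj≮σi (≢∧≮⇒> (i≢j ∘ inj σ) σi≮σj))
      where
        i≢j : i ≢ j
        i≢j refl = ℕP.<⇒≱ i<i* i*≤j
        c : Fin (size α)
        c = block (pos i)
        c≢b : c ≢ b
        c≢b = before i i<i*
        j∈b : block (pos j) ≡ b
        j∈b = after j i*≤j
        c<b : c Fin.< b
        c<b = FP.≤∧≢⇒< (subst (c Fin.≤_) j∈b (mono _ _ (pos-mono-≤ (ℕP.<⇒≤ (ℕP.<-≤-trans i<i* i*≤j))))) c≢b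
        σj≮σi : ¬ (fun σ j Fin.< fun σ i)
        σj≮σi σj<σi with b⊤ FP.≟ b
        ... | yes top∈b = FP.<-asym σj<σi
          (from (value-pos-<-⇔ i j) (from (cross (pos i) (pos j) (λ eq → c≢b (trans eq j∈b)))
            (subst (λ d → fun α c Fin.< fun α d) (trans top∈b (sym j∈b))
              (to (cross (pos i) top (λ eq → c≢b (trans eq top∈b))) (value-pos<top i)))))
        ... | no top∉b = α∈Av213 (213≼ α c b b⊤ c<b b<b⊤ αb<αc αc<αb⊤)
          where
            b<b⊤ : b Fin.< b⊤
            b<b⊤ = FP.≤∧≢⇒< (mono (pos ℓ) top (ℕP.<⇒≤ (pos<top ℓ))) (top∉b ∘ sym)
            αb<αc : fun α b Fin.< fun α c
            αb<αc = subst (λ d → fun α d Fin.< fun α c) j∈b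
              (to (cross (pos j) (pos i) (λ eq → c≢b (trans (sym eq) j∈b))) (to (value-pos-<-⇔ j i) σj<σi))
            αc<αb⊤ : fun α c Fin.< fun α b⊤
            αc<αb⊤ = to (cross (pos i) top (FP.<⇒≢ (FP.<-trans c<b b<b⊤))) (value-pos<top i)

    allInB : ∀ i → block (pos i) ≡ b
    allInB i with toℕ i* in i*≡
    ... | zero = after i (subst (ℕ._≤ toℕ i) (sym i*≡) z≤n)
    ... | suc _ = ⊥-elim (σ-indec (toℕ i* , subst (0 ℕ.<_) (sym i*≡) (s≤s z≤n) , FP.toℕ<n i* , separated))

    e : Fin n → Fin (size (τ b))
    e i = proj₁ (emb-onto b (pos i) (allInB i))

    emb-e : ∀ i → emb b (e i) ≡ pos i
    emb-e i = proj₂ (emb-onto b (pos i) (allInB i))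

    pos-mono-< : ∀ {i j} → i Fin.< j → pos i Fin.< pos j
    pos-mono-< {i} {j} = subst₂ ℕ._<_ (sym (FP.toℕ-↑ˡ i 1)) (sym (FP.toℕ-↑ˡ j 1))

  σ≼τb : σ ≼ τ b
  σ≼τb = e ,
    (λ i j i<j → StrictlyIncreasing.cancel-< (emb-incr b) (subst₂ Fin._<_ (sym (emb-e i)) (sym (emb-e j)) (pos-mono-< i<j))) ,
    λ i j → value-pos-<-⇔ i j ⟨⇔⟩
            <-resp-≡-⇔ (cong (fun (σ ⊕1)) (sym (emb-e i))) (cong (fun (σ ⊕1)) (sym (emb-e j))) ⟨⇔⟩
            ⇔-sym (emb-iso b (e i) (e j))

lastPosition : ∀ n → 0 ℕ.< n → Σ (Fin n) λ ℓ → suc (toℕ ℓ) ≡ n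
lastPosition (suc n) _ = fromℕ n , cong suc (FP.toℕ-fromℕ n)

indecomposable-⊕1∈Av213[]⇒∈ : ∀ {X} → DownClosed X → ∀ σ → SumIndecomposable σ → (Av p213 [ X ]) (σ ⊕1) → X σ
indecomposable-⊕1∈Av213[]⇒∈ X-closed σ (0<n , σ-indec) J with lastPosition (size σ) 0<n
... | ℓ , ℓ-last = X-closed σ (τ b) σ≼τb (τ∈E b)
  where
    open Inflation J using (τ; τ∈E)
    open IndecomposableInOneBlock J σ-indec ℓ ℓ-last using (b; σ≼τb)

mainTheorem19 : (x⁻ : List Letter) → Reduced (A213 ∷ x⁻) → (π : Perm) →
    ⟦ x⁻ ⟧ π ⇔ (∃[ σ ] (SumIndecomposable σ × π ≼ σ × ⟦ A213 ∷ x⁻ ⟧ (σ ⊕1)))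
mainTheorem19 x⁻ reduced π = mk⇔ cover uncover
  where
    X⁻-closed : DownClosed ⟦ x⁻ ⟧
    X⁻-closed = ⟦⟧-downClosed x⁻

    cover : ⟦ x⁻ ⟧ π → ∃[ σ ] (SumIndecomposable σ × π ≼ σ × ⟦ A213 ∷ x⁻ ⟧ (σ ⊕1))
    cover π∈X⁻ with ⟦⟧-indecomposableCover x⁻ reduced π π∈X⁻
    ... | σ , σ-indec , π≼σ , σ∈X⁻ =
      σ , σ-indec , π≼σ , ⊕1∈Av213[] X⁻-closed (⟦⟧-onePoint x⁻) σ (proj₁ σ-indec) σ∈X⁻

    uncover : ∃[ σ ] (SumIndecomposable σ × π ≼ σ × ⟦ A213 ∷ x⁻ ⟧ (σ ⊕1)) → ⟦ x⁻ ⟧ π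
    uncover (σ , σ-indec , π≼σ , σ⊕1∈X) =
      X⁻-closed π σ π≼σ (indecomposable-⊕1∈Av213[]⇒∈ X⁻-closed σ σ-indec σ⊕1∈X)
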